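{- For every $n\ge1$ and every $\epsilon\in Q_n$ there exist two trees $min(\epsilon),max(\epsilon)\in Y_n$ such that $$\phi_n^{ -1}(\epsilon)=\{t\in Y_n\mid min(\epsilon)\le t\le max(\epsilon)\}.$$
   Context: $Y_n$ ($n\ge0$) is the set of planar binary rooted trees with $n$ internal vertices, hence $n+1$ leaves numbered $1,\dots,n+1$ from left to right; for $n\ge1$ a leaf is right oriented (SW–NE) if it is the right child of its parent vertex and left oriented (SE–NW) if it is the left child. Grafting $u\vee v$: join the roots of $u$ (left) and $v$ (right) to a new vertex and add a new root. The weak order $\le$ on $Y_n$ is generated reflexively and transitively by: (a) $u\le u'$, $v\le v'$ imply $u\vee v\le u'\vee v'$; (b) $(u\vee v)\vee w\le u\vee(v\vee w)$ for all trees $u,v,w$. $Q_n=\{+1,-1\}^{n-1}$ ($Q_1$ has one element). $\phi_n:Y_n\to Q_n$ sends $t$ to $(\epsilon_1,\dots,\epsilon_{n-1})$ with $\epsilon_i=-1$ if leaf $i+1$ of $t$ is right oriented and $+1$ if it is left oriented. -}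

module Defs where

open import Data.Nat using (ℕ; zero; suc; _+_)
open import Data.List using (List; []; _∷_; _++_)
open import Data.Sign as S using (Sign)

-- Planar binary rooted trees; Y_n = trees t with size t ≡ n internal vertices.
data Tree : Set where
  leaf : Tree
  _∨_  : Tree → Tree → Tree

infixr 5 _∨_

size : Tree → ℕ
size leaf    = 0
size (u ∨ v) = suc (size u + size v)

infix 4 _≤Y_
data _≤Y_ : Tree → Tree → Set where
  ≤-refl  : ∀ {t} → t ≤Y t
  ≤-trans : ∀ {s t r} → s ≤Y t → t ≤Y r → s ≤Y r
  ≤-graft : ∀ {u u' v v'} → u ≤Y u' → v ≤Y v' → (u ∨ v) ≤Y (u' ∨ v')
  ≤-assoc : ∀ {u v w} → ((u ∨ v) ∨ w) ≤Y (u ∨ (v ∨ w))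

-- Orientation signs of the leaves of a subtree hanging as a child with
-- sign s (+ for a left child / SE–NW, - for a right child / SW–NE),
-- listed from left to right.
leafSigns : Sign → Tree → List Sign
leafSigns s leaf    = s ∷ []
leafSigns s (u ∨ v) = leafSigns S.+ u ++ leafSigns S.- v

-- Orientations of leaves 1, …, n+1 of a tree (n ≥ 1); for the one-leaf
-- tree the list is empty (φ_0 is not used).
leafOrientations : Tree → List Sign
leafOrientations leaf    = []
leafOrientations (u ∨ v) = leafSigns S.+ u ++ leafSigns S.- v

dropLast : List Sign → List Sign
dropLast []           = []
dropLast (x ∷ [])     = []
dropLast (x ∷ y ∷ xs) = x ∷ dropLast (y ∷ xs)

dropFirst : List Sign → List Sign
dropFirst []       = []
dropFirst (x ∷ xs) = xs

-- φ_n(t) = (ε_1, …, ε_{n-1}), ε_i = orientation sign of leaf i+1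
φ : Tree → List Sign
φ t = dropLast (dropFirst (leafOrientations t))

{-# OPTIONS --safe #-}
module Submission where

-- Order the leaf orientations by - < +.  A rotation (u ∨ v) ∨ w ≤ u ∨ (v ∨ w)
-- only changes the orientation of the leaves of v, and only from - to +
-- (when v is a single leaf), so φ is monotone for the pointwise order and is
-- therefore constant on every interval whose two ends have the same image.
-- Conversely, every nontrivial tree t lies below the tree maxTree (φ t) whose
-- left subtrees along the right spine are left combs: by induction on t, the
-- right subtree is rotated down to the end of the right spine.  Mirroring
-- reverses the order and turns φ t into its reversed opposite, which yields
-- the minimum.

open import Defs
open import Data.Nat using (ℕ; _≤_; _∸_; suc; z≤n; s≤s)
import Data.Nat as ℕ
open import Data.Nat.Properties using (+-identityʳ; +-comm)
open import Data.Sign using (Sign; +; -; opposite)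
open import Data.Sign.Properties using (opposite-involutive)
open import Data.Vec using (Vec; toList)
open import Data.Vec.Properties using (length-toList)
open import Data.List using (List; []; _∷_; _++_; [_]; length; map; reverse)
open import Data.List.Properties
  using (++-assoc; ++-identityʳ; map-++; map-∘; map-id; map-cong; reverse-++; unfold-reverse;
         reverse-map; reverse-involutive; length-reverse; length-map)
open import Data.List.Relation.Binary.Pointwise as Pointwise
  using (Pointwise; []; _∷_; ++⁺; Pointwise-≡⇒≡)
open import Data.Product using (_×_; _,_; proj₁; proj₂; ∃₂; map₁; uncurry)
open import Function using (_∘_; id)
open import Function.Bundles using (_⇔_; mk⇔)
open import Relation.Binary.PropositionalEquality
  using (_≡_; refl; sym; trans; cong; cong₂; subst; subst₂; module ≡-Reasoning)

infix 4 _≤±_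

data _≤±_ : Sign → Sign → Set where
  ≤±-refl : ∀ {s} → s ≤± s
  -≤+     : - ≤± +

≤±-trans : ∀ {r s t} → r ≤± s → s ≤± t → r ≤± t
≤±-trans ≤±-refl q = q
≤±-trans -≤+ ≤±-refl = -≤+

≤±-antisym : ∀ {s t} → s ≤± t → t ≤± s → s ≡ t
≤±-antisym ≤±-refl _ = refl

dropFirst⁺ : ∀ {R : Sign → Sign → Set} {xs ys} → Pointwise R xs ys → Pointwise R (dropFirst xs) (dropFirst ys)
dropFirst⁺ []       = []
dropFirst⁺ (_ ∷ ps) = ps

dropLast⁺ : ∀ {R : Sign → Sign → Set} {xs ys} → Pointwise R xs ys → Pointwise R (dropLast xs) (dropLast ys)
dropLast⁺ []               = []
dropLast⁺ (_ ∷ [])         = []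
dropLast⁺ (p ∷ ps@(_ ∷ _)) = p ∷ dropLast⁺ ps

dropLast-∷ʳ : ∀ (xs : List Sign) x → dropLast (xs ++ [ x ]) ≡ xs
dropLast-∷ʳ []           x = refl
dropLast-∷ʳ (y ∷ [])     x = refl
dropLast-∷ʳ (y ∷ z ∷ zs) x = cong (y ∷_) (dropLast-∷ʳ (z ∷ zs) x)

leafSigns-right≤left : ∀ t → Pointwise _≤±_ (leafSigns - t) (leafSigns + t)
leafSigns-right≤left leaf    = -≤+ ∷ []
leafSigns-right≤left (_ ∨ _) = Pointwise.refl ≤±-refl

leafSigns-mono : ∀ s {t t′} → t ≤Y t′ → Pointwise _≤±_ (leafSigns s t) (leafSigns s t′)
leafSigns-mono s ≤-refl        = Pointwise.refl ≤±-refl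
leafSigns-mono s (≤-trans p q) = Pointwise.transitive ≤±-trans (leafSigns-mono s p) (leafSigns-mono s q)
leafSigns-mono s (≤-graft p q) = ++⁺ (leafSigns-mono + p) (leafSigns-mono - q)
leafSigns-mono s (≤-assoc {u} {v} {w})
  rewrite ++-assoc (leafSigns + u) (leafSigns - v) (leafSigns - w)
  = ++⁺ (Pointwise.refl ≤±-refl {leafSigns + u})
        (++⁺ (leafSigns-right≤left v) (Pointwise.refl ≤±-refl {leafSigns - w}))

leafOrientations-mono : ∀ {t t′} → t ≤Y t′ → Pointwise _≤±_ (leafOrientations t) (leafOrientations t′)
leafOrientations-mono ≤-refl          = Pointwise.refl ≤±-refl
leafOrientations-mono (≤-trans p q)   = Pointwise.transitive ≤±-trans (leafOrientations-mono p) (leafOrientations-mono q)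
leafOrientations-mono p@(≤-graft _ _) = leafSigns-mono + p
leafOrientations-mono p@≤-assoc       = leafSigns-mono + p

φ-mono : ∀ {t t′} → t ≤Y t′ → Pointwise _≤±_ (φ t) (φ t′)
φ-mono = dropLast⁺ ∘ dropFirst⁺ ∘ leafOrientations-mono

φ-constant-on-interval : ∀ {s t r} → s ≤Y t → t ≤Y r → φ s ≡ φ r → φ t ≡ φ r
φ-constant-on-interval s≤t t≤r φs≡φr =
  Pointwise-≡⇒≡ (Pointwise.antisymmetric ≤±-antisym (φ-mono t≤r)
    (subst (λ xs → Pointwise _≤±_ xs _) φs≡φr (φ-mono s≤t)))

mutual
  interior : Tree → List Sign
  interior leaf    = []
  interior (u ∨ v) = interiorˡ u ++ interiorʳ v

  interiorˡ : Tree → List Sign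
  interiorˡ leaf       = []
  interiorˡ t@(_ ∨ _) = interior t ++ [ - ]

  interiorʳ : Tree → List Sign
  interiorʳ leaf       = []
  interiorʳ t@(_ ∨ _) = + ∷ interior t

mutual
  leafSigns-interior : ∀ s u v → leafSigns s (u ∨ v) ≡ + ∷ interior (u ∨ v) ++ [ - ]
  leafSigns-interior s u v =
    trans (cong₂ _++_ (leafSigns-interiorˡ u) (leafSigns-interiorʳ v))
          (cong (+ ∷_) (sym (++-assoc (interiorˡ u) (interiorʳ v) [ - ])))

  leafSigns-interiorˡ : ∀ t → leafSigns + t ≡ + ∷ interiorˡ t
  leafSigns-interiorˡ leaf    = refl
  leafSigns-interiorˡ (u ∨ v) = leafSigns-interior + u v

  leafSigns-interiorʳ : ∀ t → leafSigns - t ≡ interiorʳ t ++ [ - ]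
  leafSigns-interiorʳ leaf    = refl
  leafSigns-interiorʳ (u ∨ v) = leafSigns-interior - u v

φ≡interior : ∀ t → φ t ≡ interior t
φ≡interior leaf    = refl
φ≡interior (u ∨ v) =
  trans (cong (dropLast ∘ dropFirst) (leafSigns-interior + u v)) (dropLast-∷ʳ (interior (u ∨ v)) -)

-- maxTree (-^m₁ + -^m₂ + ⋯ + -^mₖ) = c₁ ∨ (c₂ ∨ ⋯ (cₖ ∨ leaf)) with left combs
-- cᵢ of size mᵢ; maxSplit returns the pair (c₁ , c₂ ∨ ⋯).
maxSplit : List Sign → Tree × Tree
maxSplit []      = leaf , leaf
maxSplit (+ ∷ ε) = leaf , uncurry _∨_ (maxSplit ε)
maxSplit (- ∷ ε) = map₁ (_∨ leaf) (maxSplit ε)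

maxTree : List Sign → Tree
maxTree = uncurry _∨_ ∘ maxSplit

size-maxTree : ∀ ε → size (maxTree ε) ≡ suc (length ε)
size-maxTree []      = refl
size-maxTree (+ ∷ ε) = cong suc (size-maxTree ε)
size-maxTree (- ∷ ε) rewrite +-identityʳ (size (proj₁ (maxSplit ε))) = cong suc (size-maxTree ε)

data LeftComb : Tree → Set where
  leaf : LeftComb leaf
  _∨leaf : ∀ {c} → LeftComb c → LeftComb (c ∨ leaf)

interiorˡ-∨leaf : ∀ {c} → LeftComb c → interiorˡ (c ∨ leaf) ≡ - ∷ interiorˡ c
interiorˡ-∨leaf leaf              = refl
interiorˡ-∨leaf (_∨leaf {c} comb) =
  cong (_++ [ - ]) (trans (++-identityʳ (interiorˡ (c ∨ leaf)))
    (trans (interiorˡ-∨leaf comb) (cong (- ∷_) (sym (++-identityʳ (interiorˡ c))))))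

maxSplit-leftComb : ∀ ε → LeftComb (proj₁ (maxSplit ε))
maxSplit-leftComb []      = leaf
maxSplit-leftComb (+ ∷ ε) = leaf
maxSplit-leftComb (- ∷ ε) = maxSplit-leftComb ε ∨leaf

interior-maxTree : ∀ ε → interior (maxTree ε) ≡ ε
interior-maxTree []      = refl
interior-maxTree (+ ∷ ε) = cong (+ ∷_) (interior-maxTree ε)
interior-maxTree (- ∷ ε) =
  trans (cong (_++ interiorʳ (proj₂ (maxSplit ε))) (interiorˡ-∨leaf (maxSplit-leftComb ε)))
        (cong (- ∷_) (interior-maxTree ε))

-- For a ∨ r = a₁ ∨ (a₂ ∨ ⋯ (aₖ ∨ leaf)), uncurry _∨_ (spineGraft a r x)
-- is a₁ ∨ (a₂ ∨ ⋯ ((aₖ ∨ leaf) ∨ x)).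
spineGraft : Tree → Tree → Tree → Tree × Tree
spineGraft a leaf    x = a ∨ leaf , x
spineGraft a (b ∨ c) x = a , uncurry _∨_ (spineGraft b c x)

∨-≤-spineGraft : ∀ a r x → (a ∨ r) ∨ x ≤Y uncurry _∨_ (spineGraft a r x)
∨-≤-spineGraft a leaf    x = ≤-refl
∨-≤-spineGraft a (b ∨ c) x = ≤-trans ≤-assoc (≤-graft ≤-refl (∨-≤-spineGraft b c x))

spineGraft-∨leaf : ∀ a r x → spineGraft (a ∨ leaf) r x ≡ map₁ (_∨ leaf) (spineGraft a r x)
spineGraft-∨leaf a leaf    x = refl
spineGraft-∨leaf a (b ∨ c) x = refl

maxSplit-++-∷- : ∀ ε ρ x → maxSplit ρ ≡ (leaf , x) →
                 maxSplit (ε ++ - ∷ ρ) ≡ uncurry spineGraft (maxSplit ε) x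
maxSplit-++-∷- []      ρ x eq = cong (map₁ (_∨ leaf)) eq
maxSplit-++-∷- (+ ∷ ε) ρ x eq = cong (λ p → leaf , uncurry _∨_ p) (maxSplit-++-∷- ε ρ x eq)
maxSplit-++-∷- (- ∷ ε) ρ x eq =
  trans (cong (map₁ (_∨ leaf)) (maxSplit-++-∷- ε ρ x eq))
        (sym (spineGraft-∨leaf (proj₁ (maxSplit ε)) (proj₂ (maxSplit ε)) x))

maxTree-∨-≤ : ∀ ε ρ x → maxSplit ρ ≡ (leaf , x) → maxTree ε ∨ x ≤Y maxTree (ε ++ - ∷ ρ)
maxTree-∨-≤ ε ρ x eq =
  subst (maxTree ε ∨ x ≤Y_) (cong (uncurry _∨_) (sym (maxSplit-++-∷- ε ρ x eq)))
        (∨-≤-spineGraft (proj₁ (maxSplit ε)) (proj₂ (maxSplit ε)) x)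

≤-maxTree : ∀ u v → u ∨ v ≤Y maxTree (interior (u ∨ v))
≤-maxTree leaf    leaf    = ≤-refl
≤-maxTree leaf    (c ∨ d) = ≤-graft ≤-refl (≤-maxTree c d)
≤-maxTree (a ∨ b) leaf    =
  ≤-trans (≤-graft (≤-maxTree a b) ≤-refl)
    (subst (λ ε → maxTree (interior (a ∨ b)) ∨ leaf ≤Y maxTree ε)
      (sym (++-identityʳ (interior (a ∨ b) ++ [ - ])))
      (maxTree-∨-≤ (interior (a ∨ b)) [] leaf refl))
≤-maxTree (a ∨ b) (c ∨ d) =
  ≤-trans (≤-graft (≤-maxTree a b) (≤-maxTree c d))
    (subst (λ ε → maxTree (interior (a ∨ b)) ∨ maxTree (interior (c ∨ d)) ≤Y maxTree ε)
      (sym (++-assoc (interior (a ∨ b)) [ - ] (interiorʳ (c ∨ d))))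
      (maxTree-∨-≤ (interior (a ∨ b)) (interiorʳ (c ∨ d)) (maxTree (interior (c ∨ d))) refl))

mirror : Tree → Tree
mirror leaf    = leaf
mirror (u ∨ v) = mirror v ∨ mirror u

mirror-involutive : ∀ t → mirror (mirror t) ≡ t
mirror-involutive leaf    = refl
mirror-involutive (u ∨ v) = cong₂ _∨_ (mirror-involutive u) (mirror-involutive v)

mirror-antitone : ∀ {t t′} → t ≤Y t′ → mirror t′ ≤Y mirror t
mirror-antitone ≤-refl        = ≤-refl
mirror-antitone (≤-trans p q) = ≤-trans (mirror-antitone q) (mirror-antitone p)
mirror-antitone (≤-graft p q) = ≤-graft (mirror-antitone q) (mirror-antitone p)
mirror-antitone ≤-assoc       = ≤-assoc

size-mirror : ∀ t → size (mirror t) ≡ size t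
size-mirror leaf    = refl
size-mirror (u ∨ v) =
  cong suc (trans (cong₂ ℕ._+_ (size-mirror v) (size-mirror u)) (+-comm (size v) (size u)))

dual : List Sign → List Sign
dual = reverse ∘ map opposite

dual-++ : ∀ xs ys → dual (xs ++ ys) ≡ dual ys ++ dual xs
dual-++ xs ys = trans (cong reverse (map-++ opposite xs ys)) (reverse-++ (map opposite xs) (map opposite ys))

dual-∷ : ∀ x xs → dual (x ∷ xs) ≡ dual xs ++ [ opposite x ]
dual-∷ x xs = unfold-reverse (opposite x) (map opposite xs)

dual-involutive : ∀ xs → dual (dual xs) ≡ xs
dual-involutive xs = begin
  reverse (map opposite (reverse (map opposite xs)))  ≡⟨ cong reverse (reverse-map opposite (map opposite xs)) ⟩
  reverse (reverse (map opposite (map opposite xs)))  ≡⟨ reverse-involutive _ ⟩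
  map opposite (map opposite xs)                      ≡⟨ map-∘ xs ⟨
  map (opposite ∘ opposite) xs                        ≡⟨ map-cong opposite-involutive xs ⟩
  map id xs                                           ≡⟨ map-id xs ⟩
  xs                                                  ∎
  where open ≡-Reasoning

length-dual : ∀ xs → length (dual xs) ≡ length xs
length-dual xs = trans (length-reverse (map opposite xs)) (length-map opposite xs)

mutual
  interior-mirror : ∀ t → interior (mirror t) ≡ dual (interior t)
  interior-mirror leaf    = refl
  interior-mirror (u ∨ v) =
    trans (cong₂ _++_ (interiorˡ-mirror v) (interiorʳ-mirror u)) (sym (dual-++ (interiorˡ u) (interiorʳ v)))

  interiorˡ-mirror : ∀ t → interiorˡ (mirror t) ≡ dual (interiorʳ t)
  interiorˡ-mirror leaf    = refl
  interiorˡ-mirror (u ∨ v) =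
    trans (cong (_++ [ - ]) (interior-mirror (u ∨ v))) (sym (dual-∷ + (interior (u ∨ v))))

  interiorʳ-mirror : ∀ t → interiorʳ (mirror t) ≡ dual (interiorˡ t)
  interiorʳ-mirror leaf    = refl
  interiorʳ-mirror (u ∨ v) =
    trans (cong (+ ∷_) (interior-mirror (u ∨ v))) (sym (dual-++ (interior (u ∨ v)) [ - ]))

minTree : List Sign → Tree
minTree = mirror ∘ maxTree ∘ dual

size-minTree : ∀ ε → size (minTree ε) ≡ suc (length ε)
size-minTree ε =
  trans (size-mirror (maxTree (dual ε))) (trans (size-maxTree (dual ε)) (cong suc (length-dual ε)))

interior-minTree : ∀ ε → interior (minTree ε) ≡ ε
interior-minTree ε =
  trans (interior-mirror (maxTree (dual ε)))
        (trans (cong dual (interior-maxTree (dual ε))) (dual-involutive ε))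

minTree-≤ : ∀ u v → minTree (interior (u ∨ v)) ≤Y u ∨ v
minTree-≤ u v =
  subst₂ (λ ε t → mirror (maxTree ε) ≤Y t) (interior-mirror (u ∨ v)) (mirror-involutive (u ∨ v))
         (mirror-antitone (≤-maxTree (mirror v) (mirror u)))

fibre⊆interval : ∀ {ε} u v → φ (u ∨ v) ≡ ε → minTree ε ≤Y u ∨ v × u ∨ v ≤Y maxTree ε
fibre⊆interval u v refl rewrite φ≡interior (u ∨ v) = minTree-≤ u v , ≤-maxTree u v

interval⊆fibre : ∀ {ε t} → minTree ε ≤Y t × t ≤Y maxTree ε → φ t ≡ ε
interval⊆fibre {ε} (min≤t , t≤max) =
  trans (φ-constant-on-interval min≤t t≤max (trans φ-minTree (sym φ-maxTree))) φ-maxTree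
  where
  φ-minTree : φ (minTree ε) ≡ ε
  φ-minTree = trans (φ≡interior (minTree ε)) (interior-minTree ε)
  φ-maxTree : φ (maxTree ε) ≡ ε
  φ-maxTree = trans (φ≡interior (maxTree ε)) (interior-maxTree ε)

proposition3p5 : (n : ℕ) → 1 ≤ n → (ε : Vec Sign (n ∸ 1)) →
    ∃₂ λ (mn mx : Tree) → size mn ≡ n × size mx ≡ n ×
      ((t : Tree) → size t ≡ n → (φ t ≡ toList ε ⇔ (mn ≤Y t × t ≤Y mx)))
proposition3p5 (suc m) (s≤s z≤n) ε =
  minTree εs , maxTree εs ,
  trans (size-minTree εs) (cong suc (length-toList ε)) ,
  trans (size-maxTree εs) (cong suc (length-toList ε)) ,
  λ t size-t → mk⇔ (fibre⇒interval t size-t) interval⊆fibre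
  where
  εs = toList ε
  fibre⇒interval : ∀ t → size t ≡ suc m → φ t ≡ εs → minTree εs ≤Y t × t ≤Y maxTree εs
  fibre⇒interval (u ∨ v) _ = fibre⊆interval u v
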